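{- For every $n\in\mathbb{N}$, every theorem of $\mathsf{J}_n.\mathsf{lin}$ is a theorem of $\mathsf{GLP}_n.3$.
   Context: $\mathcal{L}_{[<n]}$ is the propositional language (variables, $\top$, Boolean connectives) with modal operators $[m]$ for $m<n$ and duals $\langle m\rangle:=\lnot[m]\lnot$. $\mathsf{J}_n$ is the logic in $\mathcal{L}_{[<n]}$ with axioms: all propositional tautologies; $[k](\phi\to\psi)\to([k]\phi\to[k]\psi)$ for $k<n$; $[k]([k]\phi\to\phi)\to[k]\phi$ for $k<n$; $[k]\phi\to[k][m]\phi$ for $k\le m<n$; $[k]\phi\to[m][k]\phi$ for $k\le m<n$; $\langle k\rangle\phi\to[m]\langle k\rangle\phi$ for $k<m<n$; closed under modus ponens and necessitation (from $\phi$ infer $[k]\phi$). $\mathsf{J}_n.\mathsf{lin}$ extends $\mathsf{J}_n$ by the axioms, for each $m<n$ and formulas $\phi,\psi$: $$[m]\Big(\big(\textstyle\bigwedge_{m\le k<n}[k]\phi\big)\to\psi\Big)\vee[m]\Big(\big(\textstyle\bigwedge_{m\le k<n}[k]\psi\wedge\psi\big)\to\phi\Big).$$ $\mathsf{GLP}_n$ is the logic in $\mathcal{L}_{[<n]}$ with axioms all tautologies and, for the relevant indices below $n$: $[k](\phi\to\psi)\to([k]\phi\to[k]\psi)$; $[k]([k]\phi\to\phi)\to[k]\phi$; $[k]\phi\to[k+1]\phi$; $\langle k\rangle\phi\to[k+1]\langle k\rangle\phi$; closed under modus ponens and necessitation. $\mathsf{GLP}_n.3$ adds $[k]([k]A\to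 B)\vee[k]([k]B\wedge B\to A)$ for each $k<n$. -}

module Defs where

open import Data.Nat using (ℕ; zero; suc; _≤_; _<_)
open import Data.Fin using (Fin; toℕ)
open import Data.Bool using (Bool; true; false; _∧_; _∨_; not)
open import Data.List using (List; []; _∷_; filter)
open import Relation.Binary.PropositionalEquality using (_≡_)
open import Data.Nat.Properties using (_≤?_)
open import Data.List using (allFin)

data Fm (n : ℕ) : Set where
  var  : ℕ → Fm n
  ⊤'   : Fm n
  ⊥'   : Fm n
  ¬'_  : Fm n → Fm n
  _∧'_ : Fm n → Fm n → Fm n
  _∨'_ : Fm n → Fm n → Fm n
  _⇒_  : Fm n → Fm n → Fm n
  [_]_ : Fin n → Fm n → Fm n

infixr 4 _⇒_
infixr 5 _∨'_
infixr 6 _∧'_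
infix 7 ¬'_
infix 8 [_]_ ⟨_⟩_

⟨_⟩_ : ∀ {n} → Fin n → Fm n → Fm n
⟨ m ⟩ φ = ¬' ([ m ] (¬' φ))

-- Propositional tautologies: true under every Boolean valuation, where
-- propositional variables and modal subformulas [m]ψ are treated as atoms.
eval : ∀ {n} → (ℕ → Bool) → (Fin n → Fm n → Bool) → Fm n → Bool
eval v b (var x)    = v x
eval v b ⊤'         = true
eval v b ⊥'         = false
eval v b (¬' φ)     = not (eval v b φ)
eval v b (φ ∧' ψ)   = eval v b φ ∧ eval v b ψ
eval v b (φ ∨' ψ)   = eval v b φ ∨ eval v b ψ
eval v b (φ ⇒ ψ)    = not (eval v b φ) ∨ eval v b ψ
eval v b ([ m ] φ)  = b m φ

Tautology : ∀ {n} → Fm n → Set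
Tautology φ = ∀ v b → eval v b φ ≡ true

bigAnd : ∀ {n} → List (Fin n) → Fm n → Fm n
bigAnd []       φ = ⊤'
bigAnd (k ∷ ks) φ = ([ k ] φ) ∧' bigAnd ks φ

above : ∀ {n} → Fin n → List (Fin n)
above {n} m = filter (λ k → toℕ m ≤? toℕ k) (allFin n)

data Jlin⊢ {n : ℕ} : Fm n → Set where
  taut : ∀ {φ} → Tautology φ → Jlin⊢ φ
  K    : ∀ k φ ψ → Jlin⊢ ([ k ] (φ ⇒ ψ) ⇒ ([ k ] φ ⇒ [ k ] ψ))
  Löb  : ∀ k φ → Jlin⊢ ([ k ] ([ k ] φ ⇒ φ) ⇒ [ k ] φ)
  J1   : ∀ k m φ → toℕ k ≤ toℕ m → Jlin⊢ ([ k ] φ ⇒ [ k ] [ m ] φ)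
  J2   : ∀ k m φ → toℕ k ≤ toℕ m → Jlin⊢ ([ k ] φ ⇒ [ m ] [ k ] φ)
  J3   : ∀ k m φ → toℕ k < toℕ m → Jlin⊢ (⟨ k ⟩ φ ⇒ [ m ] ⟨ k ⟩ φ)
  lin  : ∀ m φ ψ →
         Jlin⊢ (([ m ] (bigAnd (above m) φ ⇒ ψ))
                ∨' ([ m ] ((bigAnd (above m) ψ ∧' ψ) ⇒ φ)))
  mp   : ∀ {φ ψ} → Jlin⊢ (φ ⇒ ψ) → Jlin⊢ φ → Jlin⊢ ψ
  nec  : ∀ {φ} k → Jlin⊢ φ → Jlin⊢ ([ k ] φ)

data GLP3⊢ {n : ℕ} : Fm n → Set where
  taut : ∀ {φ} → Tautology φ → GLP3⊢ φ
  K    : ∀ k φ ψ → GLP3⊢ ([ k ] (φ ⇒ ψ) ⇒ ([ k ] φ ⇒ [ k ] ψ))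
  Löb  : ∀ k φ → GLP3⊢ ([ k ] ([ k ] φ ⇒ φ) ⇒ [ k ] φ)
  mono : ∀ k k' φ → toℕ k' ≡ suc (toℕ k) → GLP3⊢ ([ k ] φ ⇒ [ k' ] φ)
  neg  : ∀ k k' φ → toℕ k' ≡ suc (toℕ k) → GLP3⊢ (⟨ k ⟩ φ ⇒ [ k' ] ⟨ k ⟩ φ)
  dot3 : ∀ k A B →
         GLP3⊢ (([ k ] ([ k ] A ⇒ B)) ∨' ([ k ] (([ k ] B ∧' B) ⇒ A)))
  mp   : ∀ {φ ψ} → GLP3⊢ (φ ⇒ ψ) → GLP3⊢ φ → GLP3⊢ ψ
  nec  : ∀ {φ} k → GLP3⊢ φ → GLP3⊢ ([ k ] φ)

-- Every axiom of J_n.lin is derivable in GLP_n.3, and both logics have the same rules.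
-- Löb's axiom yields transitivity [k]φ → [k][k]φ, and chaining the axioms [k]φ → [k+1]φ
-- gives [k]φ → [m]φ for k ≤ m; together they give J1 and J2. J3 is the GLP axiom
-- ⟨k⟩φ → [k+1]⟨k⟩φ followed by monotonicity up to m. Finally, the conjunction
-- ⋀_{m ≤ k < n} [k]φ implies [m]φ, so lin is the .3 axiom with stronger antecedents.
module Submission where

open import Defs
open import Data.Bool using (Bool; true; false; T; not; _∨_)
open import Data.Bool.Properties using (T-≡; T-∧; T-∨)
open import Data.Fin using (Fin; toℕ; fromℕ<)
open import Data.Fin.Properties using (toℕ<n; toℕ-fromℕ<; fromℕ<-toℕ)
open import Data.List.Membership.Propositional using (_∈_)
open import Data.List.Membership.Propositional.Properties using (∈-filter⁺; ∈-allFin)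
open import Data.List.Relation.Unary.Any using (here; there)
open import Data.Nat using (ℕ; suc; s≤s; _≤_; _<_; _≤′_; ≤′-refl; ≤′-step)
open import Data.Nat.Properties using (_≤?_; ≤-refl; ≤-trans; <-trans; n<1+n; ≤⇒≤′)
open import Data.Product using (_×_; _,_; proj₁; proj₂; map; map₁)
open import Data.Sum using (_⊎_)
import Data.Sum as Sum
open import Function using (_∘_)
open import Function.Bundles using (_⇔_; mk⇔; Equivalence)
open import Relation.Binary.PropositionalEquality using (_≡_; refl; sym; trans; cong; subst)

open Equivalence using (to; from)

T-⇒ : ∀ {x y} → T (not x ∨ y) ⇔ (T x → T y)
T-⇒ {false} = mk⇔ (λ _ ()) _
T-⇒ {true}  = mk⇔ (λ y _ → y) (λ f → f _)

module _ {n : ℕ} where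

  private
    G : Fm n → Set
    G = GLP3⊢

  -- A record rather than T (eval v b φ), so that φ can be inferred from it.
  record Holds (v : ℕ → Bool) (b : Fin n → Fm n → Bool) (φ : Fm n) : Set where
    constructor holds
    field truth : T (eval v b φ)

  open Holds

  module _ {v : ℕ → Bool} {b : Fin n → Fm n → Bool} {φ ψ : Fm n} where

    ⇒-holds : Holds v b (φ ⇒ ψ) ⇔ (Holds v b φ → Holds v b ψ)
    ⇒-holds = mk⇔ (λ h a → holds (to T-⇒ (truth h) (truth a)))
                  (λ f → holds (from (T-⇒ {eval v b φ}) (truth ∘ f ∘ holds)))

    ∧-holds : Holds v b (φ ∧' ψ) ⇔ (Holds v b φ × Holds v b ψ)
    ∧-holds = mk⇔ (map holds holds ∘ to (T-∧ {eval v b φ}) ∘ truth)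
                  (holds ∘ from T-∧ ∘ map truth truth)

    ∨-holds : Holds v b (φ ∨' ψ) ⇔ (Holds v b φ ⊎ Holds v b ψ)
    ∨-holds = mk⇔ (Sum.map holds holds ∘ to (T-∨ {eval v b φ}) ∘ truth)
                  (holds ∘ from T-∨ ∘ Sum.map truth truth)

  infix 3 _⊨_

  _⊨_ : Fm n → Fm n → Set
  φ ⊨ ψ = ∀ {v b} → Holds v b φ → Holds v b ψ

  ⊨⇒⊢ : ∀ {φ ψ} → φ ⊨ ψ → G (φ ⇒ ψ)
  ⊨⇒⊢ φ⊨ψ = taut λ v b → to T-≡ (truth (from ⇒-holds (φ⊨ψ {v} {b})))

  mp-⊨ : ∀ {φ ψ} → G φ → φ ⊨ ψ → G ψ
  mp-⊨ ⊢φ φ⊨ψ = mp (⊨⇒⊢ φ⊨ψ) ⊢φ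

  mp₂-⊨ : ∀ {φ ψ χ} → G φ → G ψ → (φ ∧' ψ) ⊨ χ → G χ
  mp₂-⊨ ⊢φ ⊢ψ φψ⊨χ =
    mp (mp (⊨⇒⊢ λ φ → from ⇒-holds λ ψ → φψ⊨χ (from ∧-holds (φ , ψ))) ⊢φ) ⊢ψ

  ⇒-refl : ∀ {φ} → G (φ ⇒ φ)
  ⇒-refl = ⊨⇒⊢ λ φ → φ

  ⇒-trans : ∀ {φ ψ χ} → G (φ ⇒ ψ) → G (ψ ⇒ χ) → G (φ ⇒ χ)
  ⇒-trans ⊢φψ ⊢ψχ = mp₂-⊨ ⊢φψ ⊢ψχ λ h →
    let (φ⇒ψ , ψ⇒χ) = to ∧-holds h in from ⇒-holds (to ⇒-holds ψ⇒χ ∘ to ⇒-holds φ⇒ψ)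

  ∨-map : ∀ {φ φ′ ψ ψ′} → G (φ ⇒ φ′) → G (ψ ⇒ ψ′) → G (φ ∨' ψ) → G (φ′ ∨' ψ′)
  ∨-map ⊢φφ′ ⊢ψψ′ = mp (mp₂-⊨ ⊢φφ′ ⊢ψψ′ λ h →
    let (φ⇒φ′ , ψ⇒ψ′) = to ∧-holds h
    in from ⇒-holds (from ∨-holds ∘ Sum.map (to ⇒-holds φ⇒φ′) (to ⇒-holds ψ⇒ψ′) ∘ to ∨-holds))

  box-map : ∀ {φ ψ} k → G (φ ⇒ ψ) → G ([ k ] φ ⇒ [ k ] ψ)
  box-map k ⊢φψ = mp (K k _ _) (nec k ⊢φψ)

  -- Transitivity from Löb's axiom, applied to φ ∧ [k]φ.
  box-trans : ∀ k φ → G ([ k ] φ ⇒ [ k ] [ k ] φ)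
  box-trans k φ = ⇒-trans (⇒-trans (box-map k φ⇒□χ⇒χ) (Löb k χ)) (box-map k χ⇒□φ)
    where
    χ : Fm n
    χ = φ ∧' [ k ] φ

    χ⇒□φ : G (χ ⇒ [ k ] φ)
    χ⇒□φ = ⊨⇒⊢ (proj₂ ∘ to ∧-holds)

    φ⇒□χ⇒χ : G (φ ⇒ ([ k ] χ ⇒ χ))
    φ⇒□χ⇒χ = mp-⊨ (box-map k (⊨⇒⊢ (proj₁ ∘ to ∧-holds))) λ □χ⇒□φ →
      from ⇒-holds λ φ → from ⇒-holds λ □χ → from ∧-holds (φ , to ⇒-holds □χ⇒□φ □χ)

  box-≤-fromℕ< : ∀ {k j} φ (j<n : j < n) → toℕ k ≤′ j → G ([ k ] φ ⇒ [ fromℕ< j<n ] φ)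
  box-≤-fromℕ< {k} φ j<n ≤′-refl =
    subst (λ i → G ([ k ] φ ⇒ [ i ] φ)) (sym (fromℕ<-toℕ k j<n)) ⇒-refl
  box-≤-fromℕ< {j = suc j} φ j+1<n (≤′-step k≤j) =
    ⇒-trans (box-≤-fromℕ< φ j<n k≤j) (mono _ _ φ successor)
    where
    j<n : j < n
    j<n = <-trans (n<1+n j) j+1<n
    successor : toℕ (fromℕ< j+1<n) ≡ suc (toℕ (fromℕ< j<n))
    successor = trans (toℕ-fromℕ< j+1<n) (cong suc (sym (toℕ-fromℕ< j<n)))

  box-≤ : ∀ {k m : Fin n} φ → toℕ k ≤ toℕ m → G ([ k ] φ ⇒ [ m ] φ)
  box-≤ {k} {m} φ k≤m =
    subst (λ i → G ([ k ] φ ⇒ [ i ] φ)) (fromℕ<-toℕ m (toℕ<n m)) (box-≤-fromℕ< φ (toℕ<n m) (≤⇒≤′ k≤m))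

  diamond-persistent : ∀ {k m : Fin n} φ → toℕ k < toℕ m → G (⟨ k ⟩ φ ⇒ [ m ] ⟨ k ⟩ φ)
  diamond-persistent {k} {m} φ k<m =
    ⇒-trans (neg k k′ φ k′≡k+1) (box-≤ (⟨ k ⟩ φ) (subst (_≤ toℕ m) (sym k′≡k+1) k<m))
    where
    k+1<n : suc (toℕ k) < n
    k+1<n = ≤-trans (s≤s k<m) (toℕ<n m)
    k′ : Fin n
    k′ = fromℕ< k+1<n
    k′≡k+1 : toℕ k′ ≡ suc (toℕ k)
    k′≡k+1 = toℕ-fromℕ< k+1<n

  bigAnd-⊨ : ∀ {m : Fin n} {ms} φ → m ∈ ms → bigAnd ms φ ⊨ [ m ] φ
  bigAnd-⊨ φ (here refl)   = proj₁ ∘ to ∧-holds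
  bigAnd-⊨ φ (there m∈ms) = bigAnd-⊨ φ m∈ms ∘ proj₂ ∘ to ∧-holds

  ∈-above : ∀ (m : Fin n) → m ∈ above m
  ∈-above m = ∈-filter⁺ (λ k → toℕ m ≤? toℕ k) (∈-allFin m) ≤-refl

  lin-derivable : ∀ m φ ψ →
    G (([ m ] (bigAnd (above m) φ ⇒ ψ)) ∨' ([ m ] ((bigAnd (above m) ψ ∧' ψ) ⇒ φ)))
  lin-derivable m φ ψ = ∨-map (box-map m (⊨⇒⊢ left)) (box-map m (⊨⇒⊢ right)) (dot3 m φ ψ)
    where
    left : ([ m ] φ ⇒ ψ) ⊨ (bigAnd (above m) φ ⇒ ψ)
    left h = from ⇒-holds (to ⇒-holds h ∘ bigAnd-⊨ φ (∈-above m))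
    right : (([ m ] ψ ∧' ψ) ⇒ φ) ⊨ ((bigAnd (above m) ψ ∧' ψ) ⇒ φ)
    right h = from ⇒-holds (to ⇒-holds h ∘ from ∧-holds ∘ map₁ (bigAnd-⊨ ψ (∈-above m)) ∘ to ∧-holds)

  Jlin⊢⇒GLP3⊢ : ∀ {φ : Fm n} → Jlin⊢ φ → G φ
  Jlin⊢⇒GLP3⊢ (taut ⊨φ)       = taut ⊨φ
  Jlin⊢⇒GLP3⊢ (K k φ ψ)       = K k φ ψ
  Jlin⊢⇒GLP3⊢ (Löb k φ)       = Löb k φ
  Jlin⊢⇒GLP3⊢ (J1 k m φ k≤m)  = ⇒-trans (box-trans k φ) (box-map k (box-≤ φ k≤m))
  Jlin⊢⇒GLP3⊢ (J2 k m φ k≤m)  = ⇒-trans (box-trans k φ) (box-≤ ([ k ] φ) k≤m)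
  Jlin⊢⇒GLP3⊢ (J3 k m φ k<m)  = diamond-persistent φ k<m
  Jlin⊢⇒GLP3⊢ (lin m φ ψ)     = lin-derivable m φ ψ
  Jlin⊢⇒GLP3⊢ (mp ⊢φψ ⊢φ)    = mp (Jlin⊢⇒GLP3⊢ ⊢φψ) (Jlin⊢⇒GLP3⊢ ⊢φ)
  Jlin⊢⇒GLP3⊢ (nec k ⊢φ)      = nec k (Jlin⊢⇒GLP3⊢ ⊢φ)

lemma3p3 : (n : ℕ) (φ : Fm n) → Jlin⊢ φ → GLP3⊢ φ
lemma3p3 n φ = Jlin⊢⇒GLP3⊢
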